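{- The map $\psi$ is a bijection between the elements of $P_n$ and the faces of $\Gamma(P_n)$.
   Context: $P_n=\{(L,R): L,R\subseteq[n],\ |L|=|R|,\ L\cap R=\emptyset\}$. For $(L,R)\in P_n$ with $L=\{l_1<\cdots<l_k\}$, $R=\{r_1<\cdots<r_k\}$, $\psi(L,R)=\{(l_1,r_1),\ldots,(l_k,r_k)\}$. $\Gamma(P_n)$ is the simplicial complex on vertex set $\{(l,r)\in[n]\times[n]:l\ne r\}$ whose faces are the sets of pairwise adjacent vertices, where $(l_1,r_1)$ and $(l_2,r_2)$ are adjacent iff $l_1,l_2,r_1,r_2$ are distinct and ($l_1<l_2$ iff $r_1<r_2$). -}

module Defs where

open import Data.Nat using (ℕ)
open import Data.Bool using (Bool; true; false; _∧_)
open import Data.Fin using (Fin; _<_; _≟_)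
open import Data.Fin.Subset using (Subset; _∩_; ⊥; ∣_∣)
open import Data.Fin.Subset.Properties using (_∈?_)
open import Data.List using (List; filter; zip; allFin)
open import Data.Bool.ListAction using (any)
open import Data.Vec using (Vec; lookup; tabulate)
open import Data.Product using (_×_; _,_)
open import Relation.Nullary using (¬_; does)
open import Relation.Binary.PropositionalEquality using (_≡_; _≢_)
open import Function.Bundles using (_⇔_)

InP : ∀ {n} → Subset n → Subset n → Set
InP L R = (∣ L ∣ ≡ ∣ R ∣) × (L ∩ R ≡ ⊥)

-- a set of pairs (l , r) ∈ [n] × [n], as a Boolean n×n matrix
PairSet : ℕ → Set
PairSet n = Vec (Vec Bool n) n

_∈ₚ_ : ∀ {n} → Fin n × Fin n → PairSet n → Set
(l , r) ∈ₚ F = lookup (lookup F l) r ≡ true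

-- elements of a subset listed in increasing order: l₁ < l₂ < ⋯ < l_k
elems : ∀ {n} → Subset n → List (Fin n)
elems {n} L = filter (_∈? L) (allFin n)

-- ψ(L , R) = {(l₁ , r₁) , … , (l_k , r_k)}
ψ : ∀ {n} → Subset n → Subset n → PairSet n
ψ L R = tabulate λ l → tabulate λ r →
  any (λ { (a , b) → does (a ≟ l) ∧ does (b ≟ r) }) (zip (elems L) (elems R))

IsVertex : ∀ {n} → Fin n × Fin n → Set
IsVertex (l , r) = l ≢ r

Adjacent : ∀ {n} → Fin n × Fin n → Fin n × Fin n → Set
Adjacent (l₁ , r₁) (l₂ , r₂) =
  (l₁ ≢ l₂) × (l₁ ≢ r₁) × (l₁ ≢ r₂) × (l₂ ≢ r₁) × (l₂ ≢ r₂) × (r₁ ≢ r₂)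
  × ((l₁ < l₂) ⇔ (r₁ < r₂))

IsFace : ∀ {n} → PairSet n → Set
IsFace {n} F =
  (∀ (v : Fin n × Fin n) → v ∈ₚ F → IsVertex v)
  × (∀ (v w : Fin n × Fin n) → v ∈ₚ F → w ∈ₚ F → ¬ (v ≡ w) → Adjacent v w)

-- A set F of pairs is a face of Γ(P_n) exactly when its domain and codomain are disjoint
-- and l₁ < l₂ ⇔ r₁ < r₂ for all (l₁ , r₁), (l₂ , r₂) ∈ F, i.e. F is the graph of an order
-- isomorphism from dom F onto cod F.  Between two finite chains there is at most one order
-- isomorphism, the one pairing the i-th smallest elements; as a set of pairs it is the zip
-- of the increasing enumerations, i.e. ψ (dom F) (cod F).  Conversely ψ L R is such a graph
-- with domain L and codomain R, so L and R are recovered from ψ L R.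

module Submission where

open import Defs
open import Data.Nat using (ℕ)
open import Data.Fin.Subset using (Subset)
open import Data.Product using (_×_; _,_; Σ; ∃)
open import Relation.Binary.PropositionalEquality using (_≡_)

open import Data.Nat using (zero; suc)
open import Data.Bool using (true; false; T; _∧_)
import Data.Bool as Bool
open import Data.Bool.Properties using (⇔→≡; T-≡; T-∧)
open import Data.Bool.ListAction using (any)
open import Data.Fin as Fin using (Fin; _<_; _≟_)
open import Data.Fin.Properties using (<-irrefl; <-asym; <-cmp; any?)
open import Data.Fin.Subset using (_∈_; _∉_; _∩_; ⊥; ∣_∣; inside; outside)
open import Data.Fin.Subset.Properties using (_∈?_; ⊆-antisym; Empty-unique; ∉⊥; x∈p∩q⁺; x∈p∩q⁻)
open import Data.List as List using (List; []; _∷_; length; map; filter; zip; allFin)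
open import Data.Nat.Properties using (suc-injective)
open import Data.List.Properties using (length-map)
open import Data.List.Membership.Propositional using () renaming (_∈_ to _∈ₗ_)
open import Data.List.Membership.Propositional.Properties using (∈-filter⁺; ∈-filter⁻; ∈-allFin)
open import Data.List.Relation.Unary.Any as Any using (here; there)
open import Data.List.Relation.Unary.Any.Properties using (any⇔; ¬Any[])
open import Data.List.Relation.Unary.All as All using (All)
open import Data.List.Relation.Unary.AllPairs using (AllPairs; []; _∷_)
import Data.List.Relation.Unary.AllPairs.Properties as AllPairs
open import Data.Vec as Vec using (Vec; []; _∷_; lookup; tabulate)
open import Data.Vec.Properties using (lookup∘tabulate; tabulate∘lookup; tabulate-cong; []=⇒lookup; lookup⇒[]=)
open import Data.Product using (proj₁; proj₂; uncurry)
open import Data.Product.Properties using (≡-dec)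
open import Function using (_∘_; id; const; flip)
open import Function.Bundles using (_⇔_; mk⇔; Equivalence)
open import Function.Construct.Composition using (_⇔-∘_)
open import Function.Construct.Symmetry using (⇔-sym)
import Function.Related.Propositional as Related
open import Relation.Binary.Definitions using (tri<; tri≈; tri>)
open import Relation.Binary.PropositionalEquality using (refl; sym; trans; cong; cong₂; subst; subst₂; _≢_)
open import Relation.Nullary using (Dec; yes; no; does; contradiction)

open Equivalence using (to; from)

private variable
  n : ℕ
  a b c d l r : Fin n
  L R : Subset n
  F : PairSet n

lookup-ext : ∀ {A : Set} {m} {u v : Vec A m} → (∀ i → lookup u i ≡ lookup v i) → u ≡ v
lookup-ext {u = u} {v} u≗v =
  trans (sym (tabulate∘lookup u)) (trans (tabulate-cong u≗v) (tabulate∘lookup v))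

∈-ext : {p q : Subset n} → (∀ {x} → x ∈ p ⇔ x ∈ q) → p ≡ q
∈-ext p⇔q = ⊆-antisym (to p⇔q) (from p⇔q)

∈ₚ-ext : {F G : PairSet n} → (∀ {l r} → (l , r) ∈ₚ F ⇔ (l , r) ∈ₚ G) → F ≡ G
∈ₚ-ext F⇔G = lookup-ext λ l → lookup-ext λ r → ⇔→≡ F⇔G

disjoint⇒∩≡⊥ : {p q : Subset n} → (∀ {x} → x ∈ p → x ∉ q) → p ∩ q ≡ ⊥
disjoint⇒∩≡⊥ {p = p} {q} disjoint =
  Empty-unique λ (_ , x∈p∩q) → uncurry disjoint (x∈p∩q⁻ p q x∈p∩q)

∩≡⊥⇒disjoint : {p q : Subset n} → p ∩ q ≡ ⊥ → ∀ {x} → x ∈ p → x ∉ q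
∩≡⊥⇒disjoint p∩q≡⊥ x∈p x∈q = ∉⊥ (subst (_ ∈_) p∩q≡⊥ (x∈p∩q⁺ (x∈p , x∈q)))

T-does : {A : Set} (a? : Dec A) → T (does a?) ⇔ A
T-does (yes a)  = mk⇔ (const a) (const _)
T-does (no ¬a) = mk⇔ (λ ()) ¬a

∈-tabulate-does : {P : Fin n → Set} (P? : ∀ x → Dec (P x)) {x : Fin n} →
                  x ∈ tabulate (does ∘ P?) ⇔ P x
∈-tabulate-does {P = P} P? {x} = begin
  x ∈ tabulate (does ∘ P?)               ∼⟨ mk⇔ []=⇒lookup (lookup⇒[]= x _) ⟩
  lookup (tabulate (does ∘ P?)) x ≡ true ≡⟨ cong (_≡ true) (lookup∘tabulate _ x) ⟩
  does (P? x) ≡ true                     ∼⟨ ⇔-sym T-≡ ⟩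
  T (does (P? x))                        ∼⟨ T-does (P? x) ⟩
  P x                                    ∎
  where open Related.EquationalReasoning

Increasing : List (Fin n) → Set
Increasing = AllPairs _<_

elems-increasing : (L : Subset n) → Increasing (elems L)
elems-increasing L = AllPairs.filter⁺ (_∈? L) (AllPairs.tabulate⁺-< id)

∈-elems : {x : Fin n} → x ∈ₗ elems L ⇔ x ∈ L
∈-elems {n} {L} {x} = mk⇔ (proj₂ ∘ ∈-filter⁻ (_∈? L) {xs = allFin n}) (∈-filter⁺ (_∈? L) (∈-allFin x))

filter-∈?-suc : ∀ {m} b (L : Subset n) (f : Fin m → Fin n) →
  filter (_∈? b ∷ L) (List.tabulate (Fin.suc ∘ f)) ≡ map Fin.suc (filter (_∈? L) (List.tabulate f))
filter-∈?-suc {m = zero} b L f = refl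
filter-∈?-suc {m = suc m} b L f with does (f Fin.zero ∈? L)
... | true  = cong (Fin.suc (f Fin.zero) ∷_) (filter-∈?-suc b L (f ∘ Fin.suc))
... | false = filter-∈?-suc b L (f ∘ Fin.suc)

length-elems-shift : ∀ b (L : Subset n) →
  length (filter (_∈? b ∷ L) (List.tabulate Fin.suc)) ≡ length (elems L)
length-elems-shift b L = trans (cong length (filter-∈?-suc b L id)) (length-map Fin.suc (elems L))

length-elems : (L : Subset n) → length (elems L) ≡ ∣ L ∣
length-elems []            = refl
length-elems (inside ∷ L)  = cong suc (trans (length-elems-shift inside L) (length-elems L))
length-elems (outside ∷ L) = trans (length-elems-shift outside L) (length-elems L)

module _ {A B : Set} where

  ∈-zip⁻ : ∀ {xs : List A} {ys : List B} {x y} → (x , y) ∈ₗ zip xs ys → x ∈ₗ xs × y ∈ₗ ys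
  ∈-zip⁻ {_ ∷ _} {_ ∷ _} (here refl) = here refl , here refl
  ∈-zip⁻ {_ ∷ _} {_ ∷ _} (there xy∈) = let x∈ , y∈ = ∈-zip⁻ xy∈ in there x∈ , there y∈

  ∈-zip-fst : ∀ {xs : List A} {ys : List B} {x} → length xs ≡ length ys →
              x ∈ₗ xs → ∃ λ y → (x , y) ∈ₗ zip xs ys
  ∈-zip-fst {_ ∷ _} {y ∷ _} _   (here refl) = y , here refl
  ∈-zip-fst {_ ∷ _} {_ ∷ _} |xs|≡|ys| (there x∈) =
    let y , xy∈ = ∈-zip-fst (suc-injective |xs|≡|ys|) x∈ in y , there xy∈

  ∈-zip-snd : ∀ {xs : List A} {ys : List B} {y} → length xs ≡ length ys →
              y ∈ₗ ys → ∃ λ x → (x , y) ∈ₗ zip xs ys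
  ∈-zip-snd {x ∷ _} {_ ∷ _} _   (here refl) = x , here refl
  ∈-zip-snd {_ ∷ _} {_ ∷ _} |xs|≡|ys| (there y∈) =
    let x , xy∈ = ∈-zip-snd (suc-injective |xs|≡|ys|) y∈ in x , there xy∈

-- Functionality and injectivity are not assumed: they follow because the order is also reflected.
OrderIsoGraph : (Fin n → Fin n → Set) → Set
OrderIsoGraph S = ∀ {a b c d} → S a b → S c d → (a < c ⇔ b < d)

module _ {S : Fin n → Fin n → Set} (iso : OrderIsoGraph S) where

  functional : S a b → S a d → b ≡ d
  functional {b = b} {d = d} Sab Sad with <-cmp b d
  ... | tri< b<d _ _ = contradiction (from (iso Sab Sad) b<d) (<-irrefl refl)
  ... | tri≈ _ b≡d _ = b≡d
  ... | tri> _ _ d<b = contradiction (from (iso Sad Sab) d<b) (<-irrefl refl)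

  injective : S a b → S c b → a ≡ c
  injective {a = a} {c = c} Sab Scb with <-cmp a c
  ... | tri< a<c _ _ = contradiction (to (iso Sab Scb) a<c) (<-irrefl refl)
  ... | tri≈ _ a≡c _ = a≡c
  ... | tri> _ _ c<a = contradiction (to (iso Scb Sab) c<a) (<-irrefl refl)

zip-orderIsoGraph : ∀ {xs ys : List (Fin n)} → Increasing xs → Increasing ys →
                    OrderIsoGraph (λ a b → (a , b) ∈ₗ zip xs ys)
zip-orderIsoGraph {xs = _ ∷ _} {_ ∷ _} _ _ (here refl) (here refl) =
  mk⇔ (flip contradiction (<-irrefl refl)) (flip contradiction (<-irrefl refl))
zip-orderIsoGraph {xs = _ ∷ _} {_ ∷ _} (x<xs ∷ _) (y<ys ∷ _) (here refl) (there cd∈) =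
  let c∈ , d∈ = ∈-zip⁻ cd∈ in mk⇔ (const (All.lookup y<ys d∈)) (const (All.lookup x<xs c∈))
zip-orderIsoGraph {xs = _ ∷ _} {_ ∷ _} (x<xs ∷ _) (y<ys ∷ _) (there ab∈) (here refl) =
  let a∈ , b∈ = ∈-zip⁻ ab∈
  in mk⇔ (flip contradiction (<-asym (All.lookup x<xs a∈)))
         (flip contradiction (<-asym (All.lookup y<ys b∈)))
zip-orderIsoGraph {xs = _ ∷ _} {_ ∷ _} (_ ∷ ↑xs) (_ ∷ ↑ys) (there ab∈) (there cd∈) =
  zip-orderIsoGraph ↑xs ↑ys ab∈ cd∈

HasDomain : (Fin n → Fin n → Set) → List (Fin n) → Set
HasDomain S xs = ∀ {a} → ∃ (S a) ⇔ a ∈ₗ xs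

HasCodomain : (Fin n → Fin n → Set) → List (Fin n) → Set
HasCodomain S ys = ∀ {b} → ∃ (flip S b) ⇔ b ∈ₗ ys

module Heads {S : Fin n → Fin n → Set} (iso : OrderIsoGraph S)
             {x y : Fin n} {xs ys : List (Fin n)}
             (x<xs : All (x <_) xs) (y<ys : All (y <_) ys)
             (dom : HasDomain S (x ∷ xs)) (cod : HasCodomain S (y ∷ ys)) where

  -- Take partners S x y′ and S x′ y; if x′ ≠ x then x < x′, forcing y′ < y although y is least.
  heads-related : S x y
  heads-related with from dom (here refl) | from cod (here refl)
  ... | y′ , Sxy′ | x′ , Sx′y with to dom (y , Sx′y) | to cod (x , Sxy′)
  ... | here refl   | _           = Sx′y
  ... | there _     | here refl   = Sxy′
  ... | there x′∈xs | there y′∈ys =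
    contradiction (to (iso Sxy′ Sx′y) (All.lookup x<xs x′∈xs)) (<-asym (All.lookup y<ys y′∈ys))

  Tail : Fin n → Fin n → Set
  Tail a b = S a b × a ≢ x

  tail-orderIsoGraph : OrderIsoGraph Tail
  tail-orderIsoGraph (Sab , _) (Scd , _) = iso Sab Scd

  tail-domain : HasDomain Tail xs
  tail-domain = mk⇔ domain⊆ domain⊇
    where
    domain⊆ : ∃ (Tail a) → a ∈ₗ xs
    domain⊆ (b , Sab , a≢x) with to dom (b , Sab)
    ... | here a≡x   = contradiction a≡x a≢x
    ... | there a∈xs = a∈xs
    domain⊇ : a ∈ₗ xs → ∃ (Tail a)
    domain⊇ a∈xs = let b , Sab = from dom (there a∈xs)
                   in b , Sab , λ a≡x → <-irrefl (sym a≡x) (All.lookup x<xs a∈xs)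

  tail-codomain : HasCodomain Tail ys
  tail-codomain = mk⇔ codomain⊆ codomain⊇
    where
    codomain⊆ : ∃ (flip Tail b) → b ∈ₗ ys
    codomain⊆ (a , Sab , a≢x) with to cod (a , Sab)
    ... | here b≡y   = contradiction (injective iso (subst (S a) b≡y Sab) heads-related) a≢x
    ... | there b∈ys = b∈ys
    codomain⊇ : b ∈ₗ ys → ∃ (flip Tail b)
    codomain⊇ {b} b∈ys = let a , Sab = from cod (there b∈ys)
      in a , Sab , λ a≡x → <-irrefl (functional iso heads-related (subst (flip S b) a≡x Sab))
                                     (All.lookup y<ys b∈ys)

orderIsoGraph-zip : ∀ {S : Fin n → Fin n → Set} {xs ys} →
  OrderIsoGraph S → Increasing xs → Increasing ys → HasDomain S xs → HasCodomain S ys →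
  length xs ≡ length ys × (∀ {a b} → S a b ⇔ (a , b) ∈ₗ zip xs ys)
orderIsoGraph-zip {xs = []} {[]} _ _ _ dom _ =
  refl , mk⇔ (λ Sab → contradiction (to dom (_ , Sab)) ¬Any[]) λ ()
orderIsoGraph-zip {xs = []} {_ ∷ _} _ _ _ dom cod =
  contradiction (to dom (_ , proj₂ (from cod (here refl)))) ¬Any[]
orderIsoGraph-zip {xs = _ ∷ _} {[]} _ _ _ dom cod =
  contradiction (to cod (_ , proj₂ (from dom (here refl)))) ¬Any[]
orderIsoGraph-zip {S = S} {x ∷ xs} {y ∷ ys} iso (x<xs ∷ ↑xs) (y<ys ∷ ↑ys) dom cod =
  cong suc |xs|≡|ys| , mk⇔ S⇒zip zip⇒S
  where
  open Heads iso x<xs y<ys dom cod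
  tail-zip : length xs ≡ length ys × (∀ {a b} → Tail a b ⇔ (a , b) ∈ₗ zip xs ys)
  tail-zip = orderIsoGraph-zip tail-orderIsoGraph ↑xs ↑ys tail-domain tail-codomain

  |xs|≡|ys| : length xs ≡ length ys
  |xs|≡|ys| = proj₁ tail-zip

  Tail⇔zip : Tail a b ⇔ (a , b) ∈ₗ zip xs ys
  Tail⇔zip = proj₂ tail-zip

  S⇒zip : S a b → (a , b) ∈ₗ zip (x ∷ xs) (y ∷ ys)
  S⇒zip {a} Sab with a ≟ x
  ... | yes refl = here (cong (x ,_) (functional iso Sab heads-related))
  ... | no a≢x   = there (to Tail⇔zip (Sab , a≢x))

  zip⇒S : (a , b) ∈ₗ zip (x ∷ xs) (y ∷ ys) → S a b
  zip⇒S (here refl)  = heads-related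
  zip⇒S (there ab∈) = proj₁ (from Tail⇔zip ab∈)

Graph : PairSet n → Fin n → Fin n → Set
Graph F l r = (l , r) ∈ₚ F

_∈ₚ?_ : (v : Fin n × Fin n) (F : PairSet n) → Dec (v ∈ₚ F)
(l , r) ∈ₚ? F = lookup (lookup F l) r Bool.≟ true

dom : PairSet n → Subset n
dom F = tabulate λ l → does (any? λ r → (l , r) ∈ₚ? F)

cod : PairSet n → Subset n
cod F = tabulate λ r → does (any? λ l → (l , r) ∈ₚ? F)

∈-dom : (F : PairSet n) → l ∈ dom F ⇔ ∃ (Graph F l)
∈-dom F = ∈-tabulate-does λ l → any? λ r → (l , r) ∈ₚ? F

∈-cod : (F : PairSet n) → r ∈ cod F ⇔ ∃ (flip (Graph F) r)
∈-cod F = ∈-tabulate-does λ r → any? λ l → (l , r) ∈ₚ? F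

matches⇔≡ : {a b l r : Fin n} → T (does (a ≟ l) ∧ does (b ≟ r)) ⇔ (a , b) ≡ (l , r)
matches⇔≡ {a = a} {b} {l} {r} = mk⇔
  (λ t → let ta , tb = to T-∧ t in cong₂ _,_ (to (T-does (a ≟ l)) ta) (to (T-does (b ≟ r)) tb))
  (λ { refl → from T-∧ (from (T-does (a ≟ l)) refl , from (T-does (b ≟ r)) refl) })

∈ₚ-ψ : (L R : Subset n) → (l , r) ∈ₚ ψ L R ⇔ (l , r) ∈ₗ zip (elems L) (elems R)
∈ₚ-ψ {l = l} {r = r} L R = mk⇔
  (Any.map (λ {(a , b)} → sym ∘ to matches⇔≡) ∘ from any⇔ ∘ from T-≡ ∘ trans (sym entry))
  (trans entry ∘ to T-≡ ∘ to any⇔ ∘ Any.map (λ {(a , b)} → from matches⇔≡ ∘ sym))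
  where
  entry : lookup (lookup (ψ L R) l) r ≡ any _ (zip (elems L) (elems R))
  entry = trans (cong (λ row → lookup row r) (lookup∘tabulate _ l)) (lookup∘tabulate _ r)

length-elems-≡ : (L R : Subset n) → ∣ L ∣ ≡ ∣ R ∣ → length (elems L) ≡ length (elems R)
length-elems-≡ L R |L|≡|R| = trans (length-elems L) (trans |L|≡|R| (sym (length-elems R)))

ψ-hasDomain : (L R : Subset n) → ∣ L ∣ ≡ ∣ R ∣ → HasDomain (Graph (ψ L R)) (elems L)
ψ-hasDomain L R |L|≡|R| = mk⇔
  (λ (_ , lr∈) → proj₁ (∈-zip⁻ (to (∈ₚ-ψ L R) lr∈)))
  (λ l∈ → let r , lr∈ = ∈-zip-fst (length-elems-≡ L R |L|≡|R|) l∈ in r , from (∈ₚ-ψ L R) lr∈)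

ψ-hasCodomain : (L R : Subset n) → ∣ L ∣ ≡ ∣ R ∣ → HasCodomain (Graph (ψ L R)) (elems R)
ψ-hasCodomain L R |L|≡|R| = mk⇔
  (λ (_ , lr∈) → proj₂ (∈-zip⁻ (to (∈ₚ-ψ L R) lr∈)))
  (λ r∈ → let l , lr∈ = ∈-zip-snd (length-elems-≡ L R |L|≡|R|) r∈ in l , from (∈ₚ-ψ L R) lr∈)

dom-hasDomain : (F : PairSet n) → HasDomain (Graph F) (elems (dom F))
dom-hasDomain F = ⇔-sym ∈-elems ⇔-∘ ⇔-sym (∈-dom F)

dom-unique : (F : PairSet n) → HasDomain (Graph F) (elems L) → dom F ≡ L
dom-unique F hasDomain = ∈-ext (∈-elems ⇔-∘ (hasDomain ⇔-∘ ∈-dom F))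

cod-hasCodomain : (F : PairSet n) → HasCodomain (Graph F) (elems (cod F))
cod-hasCodomain F = ⇔-sym ∈-elems ⇔-∘ ⇔-sym (∈-cod F)

cod-unique : (F : PairSet n) → HasCodomain (Graph F) (elems R) → cod F ≡ R
cod-unique F hasCodomain = ∈-ext (∈-elems ⇔-∘ (hasCodomain ⇔-∘ ∈-cod F))

_≟ₚ_ : (v w : Fin n × Fin n) → Dec (v ≡ w)
_≟ₚ_ = ≡-dec _≟_ _≟_

isFace⇔ : (F : PairSet n) → IsFace F ⇔ (OrderIsoGraph (Graph F) × dom F ∩ cod F ≡ ⊥)
isFace⇔ F = mk⇔ face⇒ face⇐
  where
  face⇒ : IsFace F → OrderIsoGraph (Graph F) × dom F ∩ cod F ≡ ⊥
  face⇒ (vertex , adjacent) = iso , disjoint⇒∩≡⊥ disjoint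
    where
    iso : OrderIsoGraph (Graph F)
    iso {a} {b} {c} {d} ab∈ cd∈ with (a , b) ≟ₚ (c , d)
    ... | yes refl = mk⇔ (flip contradiction (<-irrefl refl)) (flip contradiction (<-irrefl refl))
    ... | no ab≢cd = let (_ , _ , _ , _ , _ , _ , a<c⇔b<d) = adjacent _ _ ab∈ cd∈ ab≢cd in a<c⇔b<d
    disjoint : ∀ {x} → x ∈ dom F → x ∉ cod F
    disjoint {x} x∈dom x∈cod with to (∈-dom F) x∈dom | to (∈-cod F) x∈cod
    ... | r , xr∈ | l , lx∈ with (x , r) ≟ₚ (l , x)
    ... | yes xr≡lx = vertex _ xr∈ (sym (cong proj₂ xr≡lx))
    ... | no xr≢lx  = let (_ , _ , x≢x , _) = adjacent _ _ xr∈ lx∈ xr≢lx in x≢x refl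

  face⇐ : OrderIsoGraph (Graph F) × dom F ∩ cod F ≡ ⊥ → IsFace F
  face⇐ (iso , dom∩cod≡⊥) = (λ _ lr∈ → apart lr∈ lr∈) , adjacent
    where
    apart : ∀ {l r l′ r′} → (l , r) ∈ₚ F → (l′ , r′) ∈ₚ F → l ≢ r′
    apart {l} lr∈ l′r′∈ refl =
      ∩≡⊥⇒disjoint dom∩cod≡⊥ (from (∈-dom F) (_ , lr∈)) (from (∈-cod F) (_ , l′r′∈))
    adjacent : ∀ v w → v ∈ₚ F → w ∈ₚ F → v ≢ w → Adjacent v w
    adjacent (l₁ , r₁) (l₂ , r₂) v∈ w∈ v≢w =
      (λ { refl → v≢w (cong (l₁ ,_) (functional iso v∈ w∈)) }) ,
      apart v∈ v∈ , apart v∈ w∈ , apart w∈ v∈ , apart w∈ w∈ ,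
      (λ { refl → v≢w (cong (_, r₁) (injective iso v∈ w∈)) }) ,
      iso v∈ w∈

ψ-orderIsoGraph : (L R : Subset n) → OrderIsoGraph (Graph (ψ L R))
ψ-orderIsoGraph L R ab∈ cd∈ =
  zip-orderIsoGraph (elems-increasing L) (elems-increasing R) (to (∈ₚ-ψ L R) ab∈) (to (∈ₚ-ψ L R) cd∈)

dom-ψ : (L R : Subset n) → ∣ L ∣ ≡ ∣ R ∣ → dom (ψ L R) ≡ L
dom-ψ L R |L|≡|R| = dom-unique (ψ L R) (ψ-hasDomain L R |L|≡|R|)

cod-ψ : (L R : Subset n) → ∣ L ∣ ≡ ∣ R ∣ → cod (ψ L R) ≡ R
cod-ψ L R |L|≡|R| = cod-unique (ψ L R) (ψ-hasCodomain L R |L|≡|R|)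

ψ-isFace : (L R : Subset n) → InP L R → IsFace (ψ L R)
ψ-isFace L R (|L|≡|R| , L∩R≡⊥) = from (isFace⇔ (ψ L R))
  (ψ-orderIsoGraph L R ,
   subst₂ (λ p q → p ∩ q ≡ ⊥) (sym (dom-ψ L R |L|≡|R|)) (sym (cod-ψ L R |L|≡|R|)) L∩R≡⊥)

ψ-injective : (L R L′ R′ : Subset n) → InP L R → InP L′ R′ → ψ L R ≡ ψ L′ R′ → L ≡ L′ × R ≡ R′
ψ-injective L R L′ R′ (|L|≡|R| , _) (|L′|≡|R′| , _) ψ≡ψ′ =
  trans (sym (dom-ψ L R |L|≡|R|)) (trans (cong dom ψ≡ψ′) (dom-ψ L′ R′ |L′|≡|R′|)) ,
  trans (sym (cod-ψ L R |L|≡|R|)) (trans (cong cod ψ≡ψ′) (cod-ψ L′ R′ |L′|≡|R′|))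

isFace⇒ψ-dom-cod : (F : PairSet n) → IsFace F → InP (dom F) (cod F) × ψ (dom F) (cod F) ≡ F
isFace⇒ψ-dom-cod F face
  with iso , dom∩cod≡⊥ ← to (isFace⇔ F) face
  with |dom|≡|cod| , F⇔zip ← orderIsoGraph-zip iso (elems-increasing (dom F)) (elems-increasing (cod F))
                                                (dom-hasDomain F) (cod-hasCodomain F) =
  (trans (sym (length-elems (dom F))) (trans |dom|≡|cod| (length-elems (cod F))) , dom∩cod≡⊥) ,
  ∈ₚ-ext (⇔-sym F⇔zip ⇔-∘ ∈ₚ-ψ (dom F) (cod F))

proposition4p13 : (n : ℕ) →
    ((L R : Subset n) → InP L R → IsFace (ψ L R))
    × ((L R L′ R′ : Subset n) → InP L R → InP L′ R′ → ψ L R ≡ ψ L′ R′ → (L ≡ L′) × (R ≡ R′))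
    × ((F : PairSet n) → IsFace F → Σ (Subset n) λ L → Σ (Subset n) λ R → InP L R × (ψ L R ≡ F))
proposition4p13 n = ψ-isFace , ψ-injective , λ F face → dom F , cod F , isFace⇒ψ-dom-cod F face
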